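{- Let $\mathscr{G}=(V,E)$ be a finite undirected graph, and let $\mathscr{S}_G$ be the FTS constructed from $\mathscr{G}$ as described in the context. Let $\mathscr{S}'_G$ be an FTS with the minimal number of states among all FTS that are coherent branching feature bisimilar to $\mathscr{S}_G$. Then the number of states of $\mathscr{S}'_G$ equals the chromatic number of $\mathscr{G}$ plus $2$.
   Context: Feature transition systems (FTS): given features $\mathscr{F}$, products $\mathscr{P}\subseteq 2^{\mathscr{F}}$, actions $\mathscr{A}$ and silent action $\tau$ ($\mathscr{A}_\tau=\mathscr{A}\cup\{\tau\}$), an FTS is $(S,\theta,s^\circ)$ with $\theta:S\times\mathscr{A}_\tau\times S\to\mathbb{B}(\mathscr{F})$ (Boolean expressions over $\mathscr{F}$) and initial state $s^\circ$. $P\models\varphi$ means $\varphi$ is true when features in $P$ are true and others false; feature expressions are identified modulo $\varphi\sim_{\mathscr{P}}\psi$ (same products in $\mathscr{P}$ satisfy them), $\hat\varphi$ being the class. Write $s\xrightarrow{\alpha|\psi}s'$ if $\theta(s,\alpha,s')=\psi$ is satisfiable. The reachability function $\varrho$ satisfies: $P\models\varrho(s)$ iff $s$ is reachable from $s^\circ$ by transitions whose constraints $P$ satisfies. $s\Rightarrow_\eta s'$ denotes a possibly empty sequence of $\tau$-transitions from $s$ to $s'$ whose constraints have conjunction $\eta$; $s\xrightarrow{(\alpha|\psi)}s'$ means $s\xrightarrow{\alpha|\psi}s'$ or ($\alpha=\tau$, $s=s'$, $\psi=\mathit{true}$). A symmetric relation $R$ on states $\times$ classes of feature expressions $\times$ states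 (of the disjoint union of two FTS) is a branching feature bisimulation if whenever $R(s,\hat\varphi,t)$ and $s\xrightarrow{\alpha|\psi}s'$, there are $n$ and, for $i\le n$, $\hat t_i,t'_i,\eta_i,\psi_i,\varphi_i,\varphi'_i$ with $t\Rightarrow_{\eta_i}\hat t_i\xrightarrow{(\alpha|\psi_i)}t'_i$, $R(s,\hat\varphi_i,\hat t_i)$, $R(s',\hat\varphi'_i,t'_i)$, and every $P\in\mathscr{P}$ with $P\models\varphi\wedge\psi$ satisfies $\bigvee_i(\eta_i\wedge\psi_i\wedge\varphi_i\wedge\varphi'_i)$. It is coherent (for $\mathscr{S},\mathscr{S}'$) if $R(s,\hat\varphi,s')$ with $s$ in $\mathscr{S}$ implies every product satisfying $\varrho(s)$ satisfies $\varphi$. Two FTS are coherent branching feature bisimilar if such a coherent relation relates their initial states by $\widehat{\mathit{true}}$. Construction: $\mathscr{A}=\{a\}$, $\mathscr{F}=\{f_v\mid v\in V\}$, $\mathscr{P}=\{P_v\mid v\in V\}$ with $P_v=\{f_v\}$. $\mathscr{S}_G=(S_G,\theta_G,s_1)$ with $S_G=\{s_1,s_2\}\cup\{s_v\mid v\in V\}$ (all distinct), $\theta_G(s_1,a,s_v)=\bigvee\{f_u\mid \{u,v\}\in E\}\vee f_v$ for all $v\in V$, $\theta_G(s_v,a,s_2)=f_v$ for all $v\in V$, and $\theta_G(s,\alpha,s')=\mathit{false}$ in all other cases. -}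

module Defs where

open import Data.Nat using (ℕ; _≤_)
open import Data.Fin using (Fin; zero; suc; _≟_)
open import Data.Bool using (Bool; true; false; _∧_; _∨_; not; if_then_else_)
open import Data.List using (List; foldr)
open import Data.List.Base using (allFin)
open import Data.Product using (Σ; ∃; _×_; _,_)
open import Data.Sum using (_⊎_; inj₁; inj₂)
open import Relation.Nullary using (does)
open import Relation.Binary.PropositionalEquality using (_≡_)

record Graph (n : ℕ) : Set where
  field
    adj    : Fin n → Fin n → Bool
    sym    : ∀ u v → adj u v ≡ adj v u
    irrefl : ∀ v → adj v v ≡ false
open Graph public

Colorable : ∀ {n} → Graph n → ℕ → Set
Colorable {n} G k =
  Σ (Fin n → Fin k) λ c → ∀ u v → adj G u v ≡ true → c u ≡ c v → Data.Empty.⊥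
  where import Data.Empty

IsChromaticNumber : ∀ {n} → Graph n → ℕ → Set
IsChromaticNumber G χ = Colorable G χ × (∀ k → Colorable G k → χ ≤ k)

-- Feature expressions over the features f_v (v : Fin n).

data FExpr (n : ℕ) : Set where
  var       : Fin n → FExpr n
  tt ff     : FExpr n
  _∧ᶠ_ _∨ᶠ_ : FExpr n → FExpr n → FExpr n
  ¬ᶠ_       : FExpr n → FExpr n

-- Products are P_v = {f_v}, indexed by v : Fin n.
-- sat v e  =  (P_v ⊨ e)
sat : ∀ {n} → Fin n → FExpr n → Bool
sat v (var u)  = does (u ≟ v)
sat v tt       = true
sat v ff       = false
sat v (e ∧ᶠ e') = sat v e ∧ sat v e'
sat v (e ∨ᶠ e') = sat v e ∨ sat v e'
sat v (¬ᶠ e)   = not (sat v e)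

_⊨_ : ∀ {n} → Fin n → FExpr n → Set
v ⊨ e = sat v e ≡ true

Satisfiable : ∀ {n} → FExpr n → Set
Satisfiable e = ∃ λ v → v ⊨ e

data Act : Set where
  a τ : Act

record FTS (n : ℕ) : Set where
  field
    states : ℕ
    θ      : Fin states → Act → Fin states → FExpr n
    init   : Fin states
open FTS public

-- reachability: P_v ⊨ ϱ(s)  iff  Reach S v s
data Reach {n} (S : FTS n) (v : Fin n) : Fin (states S) → Set where
  here : Reach S v (init S)
  step : ∀ {s α s'} → Reach S v s → v ⊨ θ S s α s' → Reach S v s'

module Bisim {n : ℕ} {St : Set} (θ : St → Act → St → FExpr n) where

  Step : St → Act → FExpr n → St → Set
  Step s α ψ s' = (θ s α s' ≡ ψ) × Satisfiable ψ

  data TauPath : St → FExpr n → St → Set where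
    done : ∀ {s} → TauPath s tt s
    more : ∀ {s s'' t ψ η} → Step s τ ψ s'' → TauPath s'' η t → TauPath s (ψ ∧ᶠ η) t

  OptStep : St → Act → FExpr n → St → Set
  OptStep s α ψ s' = Step s α ψ s' ⊎ ((α ≡ τ) × (s ≡ s') × (ψ ≡ tt))

  Rel : Set₁
  Rel = St → FExpr n → St → Set

  record Answer (R : Rel) (s t : St) (α : Act) (s' : St) : Set where
    field
      t̂ t' : St
      η ψ' φ φ' : FExpr n
      path : TauPath t η t̂
      move : OptStep t̂ α ψ' t'
      rel₁ : R s φ t̂
      rel₂ : R s' φ' t'
    cond : FExpr n
    cond = η ∧ᶠ (ψ' ∧ᶠ (φ ∧ᶠ φ'))

  IsBranchingFeatureBisim : Rel → Set
  IsBranchingFeatureBisim R =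
    (∀ {s φ t} → R s φ t → R t φ s) ×
    (∀ {s φ t α ψ s'} → R s φ t → Step s α ψ s' →
       Σ ℕ λ k → Σ (Fin k → Answer R s t α s') λ ans →
         ∀ v → v ⊨ (φ ∧ᶠ ψ) → ∃ λ i → v ⊨ Answer.cond (ans i))

UState : ∀ {n} → FTS n → FTS n → Set
UState S S' = Fin (states S) ⊎ Fin (states S')

θ⊎ : ∀ {n} (S S' : FTS n) → UState S S' → Act → UState S S' → FExpr n
θ⊎ S S' (inj₁ s) α (inj₁ s') = θ S s α s'
θ⊎ S S' (inj₂ s) α (inj₂ s') = θ S' s α s'
θ⊎ S S' _        _ _         = ff

Coherent : ∀ {n} (S S' : FTS n) → Bisim.Rel (θ⊎ S S') → Set
Coherent S S' R =
  ∀ s φ t → R (inj₁ s) φ t → ∀ v → Reach S v s → v ⊨ φ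

CBFBisimilar : ∀ {n} → FTS n → FTS n → Set₁
CBFBisimilar S S' =
  Σ (Bisim.Rel (θ⊎ S S')) λ R →
    Bisim.IsBranchingFeatureBisim (θ⊎ S S') R ×
    Coherent S S' R ×
    R (inj₁ (init S)) tt (inj₂ (init S'))

-- The FTS S_G. States Fin (2 + n): zero = s₁, suc zero = s₂, suc (suc v) = s_v.

nbhd : ∀ {n} → Graph n → Fin n → FExpr n
nbhd {n} G v =
  foldr (λ u acc → if adj G u v then var u ∨ᶠ acc else acc) ff (allFin n) ∨ᶠ var v

θG : ∀ {n} → Graph n → Fin (2 Data.Nat.+ n) → Act → Fin (2 Data.Nat.+ n) → FExpr n
θG G zero          a (suc (suc v)) = nbhd G v
θG G (suc (suc v)) a (suc zero)    = var v
θG G _             _ _             = ff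

SG : ∀ {n} → Graph n → FTS n
SG {n} G = record { states = 2 Data.Nat.+ n ; θ = θG G ; init = zero }

module Submission where

-- Write χ for the chromatic number of G.  S_G, and the FTS
-- built for the upper bound, are two-layer FTSs: a root, a sink, and middle
-- states entered from the root and left towards the sink.
--
-- Upper bound (UpperBound): a proper colouring c with χ colours gives an FTS
-- with χ + 2 states, obtained from S_G by merging the middle states s_v of each
-- colour class k into one state, entered under ⋁{nbhd v ∣ c v = k} and left
-- under ⋁{f_v ∣ c v = k}.  Colour classes are independent sets, so a product
-- reaching s_v that can leave the merged state is P_v itself; hence the evident
-- relation is a coherent branching feature bisimulation, and minimality bounds
-- the number of states of S' by χ + 2.
--
-- Lower bound (LowerBound): S_G is τ-free, so a weak a-move of a partner of an
-- S_G-state is answered by a single a-step of that state.  Let cU v be the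
-- state in which S' replies to s₁ → s_v for P_v, and d the state in which it
-- replies to a move into s₂.  Coherence and the f_u-guarded exit of s_u give
-- cU u ≠ cU v for adjacent u, v; cU v is never the initial state; and since s₂
-- is deadlocked and reached by every product, d is neither the initial state
-- nor any cU v.  Removing these two states turns cU into a proper colouring
-- with #states − 2 colours, whence χ + 2 ≤ #states.

open import Defs hiding (sym)
open import Data.Nat using (ℕ; zero; suc; _+_; _≤_)
open import Data.Nat.Properties
  using (≤-antisym; ≤-trans; ≤-reflexive; +-comm; +-monoˡ-≤; module ≤-Reasoning)
open import Data.Fin using (Fin; zero; suc; _≟_; punchOut; fromℕ<)
open import Data.Fin.Properties using (punchOut-injective)
open import Data.Bool using (Bool; true; false; if_then_else_)
open import Data.Bool.Properties using (∧-conicalˡ; ∧-conicalʳ; ∨-zeroʳ)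
open import Data.List using (List; []; _∷_; foldr)
open import Data.List.Base using (allFin)
open import Data.List.Membership.Propositional.Properties using (∈-allFin)
open import Data.List.Membership.Propositional using (_∈_)
open import Data.List.Relation.Unary.Any using (here; there)
open import Data.Product using (Σ; ∃; _×_; _,_; proj₁; proj₂)
open import Data.Sum using (_⊎_; inj₁; inj₂; swap)
open import Data.Empty using (⊥; ⊥-elim)
open import Relation.Nullary using (¬_; Dec; does; yes; no)
open import Relation.Nullary.Decidable using (dec-true)
open import Relation.Binary.PropositionalEquality using (_≡_; _≢_; refl; sym; trans; subst; cong)

private variable
  n : ℕ
  w u : Fin n

⊨-∧ : ∀ (φ ψ : FExpr n) → w ⊨ (φ ∧ᶠ ψ) → w ⊨ φ × w ⊨ ψ
⊨-∧ {w = w} φ ψ h = ∧-conicalˡ (sat w φ) (sat w ψ) h , ∧-conicalʳ (sat w φ) (sat w ψ) h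

∧ᶠ-intro : ∀ (φ ψ : FExpr n) → w ⊨ φ → w ⊨ ψ → w ⊨ (φ ∧ᶠ ψ)
∧ᶠ-intro _ _ hφ hψ rewrite hφ | hψ = refl

∨ᶠ-introˡ : ∀ (φ ψ : FExpr n) → w ⊨ φ → w ⊨ (φ ∨ᶠ ψ)
∨ᶠ-introˡ _ _ hφ rewrite hφ = refl

∨ᶠ-introʳ : ∀ (φ ψ : FExpr n) → w ⊨ ψ → w ⊨ (φ ∨ᶠ ψ)
∨ᶠ-introʳ {w = w} φ _ hψ rewrite hψ = ∨-zeroʳ (sat w φ)

∨ᶠ-elim : ∀ (φ ψ : FExpr n) → w ⊨ (φ ∨ᶠ ψ) → w ⊨ φ ⊎ w ⊨ ψ
∨ᶠ-elim {w = w} φ _ h with sat w φ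
... | true  = inj₁ refl
... | false = inj₂ h

var-self : ∀ (v : Fin n) → v ⊨ var v
var-self v = dec-true (v ≟ v) refl

does-true : ∀ {A : Set} (d : Dec A) → does d ≡ true → A
does-true (yes x) _ = x

⊨-var : w ⊨ var u → u ≡ w
⊨-var {w = w} {u = u} = does-true (u ≟ w)

-- ⋁ b e us is the disjunction of the e u with u ∈ us and b u, built exactly as
-- the neighbourhood guards nbhd G v are.
⋁ : (Fin n → Bool) → (Fin n → FExpr n) → List (Fin n) → FExpr n
⋁ b e = foldr (λ u acc → if b u then e u ∨ᶠ acc else acc) ff

⋁-intro : ∀ (b : Fin n → Bool) (e : Fin n → FExpr n) {us} →
  u ∈ us → b u ≡ true → w ⊨ e u → w ⊨ ⋁ b e us
⋁-intro b e {_ ∷ us} (here refl) bu h rewrite bu = ∨ᶠ-introˡ (e _) (⋁ b e us) h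
⋁-intro b e {x ∷ us} (there m) bu h with b x
... | true  = ∨ᶠ-introʳ (e x) (⋁ b e us) (⋁-intro b e m bu h)
... | false = ⋁-intro b e m bu h

⋁-elim : ∀ (b : Fin n → Bool) (e : Fin n → FExpr n) us →
  w ⊨ ⋁ b e us → ∃ λ u → b u ≡ true × w ⊨ e u
⋁-elim b e []       ()
⋁-elim b e (x ∷ us) h with b x in bx
... | false = ⋁-elim b e us h
... | true with ∨ᶠ-elim (e x) (⋁ b e us) h
...   | inj₁ hx = x , bx , hx
...   | inj₂ h′ = ⋁-elim b e us h′

nbhd-self : ∀ (G : Graph n) v → v ⊨ nbhd G v
nbhd-self {n} G v = ∨ᶠ-introʳ (⋁ (λ u → adj G u v) var (allFin n)) (var v) (var-self v)

nbhd-adj : ∀ (G : Graph n) {w v} → adj G w v ≡ true → w ⊨ nbhd G v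
nbhd-adj {n} G {w} {v} e =
  ∨ᶠ-introˡ (⋁ (λ u → adj G u v) var (allFin n)) (var v)
    (⋁-intro (λ u → adj G u v) var (∈-allFin w) e (var-self w))

nbhd-elim : ∀ (G : Graph n) {w v} → w ⊨ nbhd G v → adj G w v ≡ true ⊎ w ≡ v
nbhd-elim {n} G {w} {v} h with ∨ᶠ-elim (⋁ (λ u → adj G u v) var (allFin n)) (var v) h
... | inj₂ hv = inj₂ (sym (⊨-var {w = w} {u = v} hv))
... | inj₁ hN with ⋁-elim (λ u → adj G u v) var (allFin n) hN
...   | u , e , hu with ⊨-var {w = w} {u = u} hu
...     | refl = inj₁ e

pattern root  = zero
pattern sink  = suc zero
pattern mid i = suc (suc i)

layered : ∀ {k} (L M : Fin k → FExpr n) → Fin (2 + k) → Act → Fin (2 + k) → FExpr n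
layered L M root    a (mid i) = L i
layered L M (mid i) a sink    = M i
layered L M _       _ _       = ff

data Move {k} (L M : Fin k → FExpr n) : Fin (2 + k) → Act → FExpr n → Fin (2 + k) → Set where
  enter : ∀ i → Move L M root a (L i) (mid i)
  exit  : ∀ i → Move L M (mid i) a (M i) sink

layered-move : ∀ {k} {L M : Fin k → FExpr n} {ψ} s α s' →
  layered L M s α s' ≡ ψ → Satisfiable ψ → Move L M s α ψ s'
layered-move root    a (mid i)  refl _      = enter i
layered-move (mid i) a sink     refl _      = exit i
layered-move root    a root     refl (_ , ())
layered-move root    a sink     refl (_ , ())
layered-move root    τ _        refl (_ , ())
layered-move sink    _ _        refl (_ , ())
layered-move (mid i) a root     refl (_ , ())
layered-move (mid i) a (mid j)  refl (_ , ())
layered-move (mid i) τ _        refl (_ , ())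

θG-layered : ∀ (G : Graph n) s α s' → θG G s α s' ≡ layered (nbhd G) var s α s'
θG-layered G root    a root    = refl
θG-layered G root    a sink    = refl
θG-layered G root    a (mid v) = refl
θG-layered G root    τ _       = refl
θG-layered G sink    _ _       = refl
θG-layered G (mid v) a root    = refl
θG-layered G (mid v) a sink    = refl
θG-layered G (mid v) a (mid u) = refl
θG-layered G (mid v) τ _       = refl

sg-move : ∀ (G : Graph n) {ψ} s α s' →
  θG G s α s' ≡ ψ → Satisfiable ψ → Move (nbhd G) var s α ψ s'
sg-move G s α s' eq = layered-move s α s' (trans (sym (θG-layered G s α s')) eq)

reach-mid : ∀ (G : Graph n) {w v} → Reach (SG G) w (mid v) → w ⊨ nbhd G v
reach-mid G (step {s} {α} {s'} r h) with sg-move G s α s' refl (_ , h)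
... | enter v = h

reach-mid-intro : ∀ (G : Graph n) {w v} → w ⊨ nbhd G v → Reach (SG G) w (mid v)
reach-mid-intro G h = step {s = root} {α = a} here h

reach-sink : ∀ (G : Graph n) w → Reach (SG G) w sink
reach-sink G w = step {s = mid w} {α = a} (reach-mid-intro G (nbhd-self G w)) (var-self w)

sg-τ-free : ∀ (G : Graph n) s s' → ¬ Satisfiable (θG G s τ s')
sg-τ-free G s s' sat with sg-move G s τ s' refl sat
... | ()

module Replies {St : Set} (θ : St → Act → St → FExpr n) where
  open Bisim θ

  record Reply (R : Rel) (t : St) (α : Act) (w : Fin n) (s' : St) : Set where
    field
      t̂ t'       : St
      η ψ φ'     : FExpr n
      path       : TauPath t η t̂
      move       : OptStep t̂ α ψ t'
      related    : R s' φ' t'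
      path-ok    : w ⊨ η
      move-ok    : w ⊨ ψ
      related-ok : w ⊨ φ'

  -- Each move of s is replied to by its partner t, for every product enabling it:
  -- this selects the answer that covers the product in the bisimulation clause.
  reply : ∀ {R s φ t α ψ s' w} → IsBranchingFeatureBisim R →
    R s φ t → Step s α ψ s' → w ⊨ φ → w ⊨ ψ → Reply R t α w s'
  reply {φ = φ} {ψ = ψ} {w = w} (_ , answers) r st hφ hψ with answers r st
  ... | _ , ans , covered with covered w (∧ᶠ-intro φ ψ hφ hψ)
  ... | i , c = record
    { path = path ; move = move ; related = rel₂
    ; path-ok = hη ; move-ok = hψ' ; related-ok = hφ' }
    where
    open Answer (ans i) renaming (φ to φᵢ)
    hη : w ⊨ η
    hη = proj₁ (⊨-∧ η (ψ' ∧ᶠ (φᵢ ∧ᶠ φ')) c)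
    hψ'φᵢφ' : w ⊨ (ψ' ∧ᶠ (φᵢ ∧ᶠ φ'))
    hψ'φᵢφ' = proj₂ (⊨-∧ η (ψ' ∧ᶠ (φᵢ ∧ᶠ φ')) c)
    hψ' : w ⊨ ψ'
    hψ' = proj₁ (⊨-∧ ψ' (φᵢ ∧ᶠ φ') hψ'φᵢφ')
    hφ' : w ⊨ φ'
    hφ' = proj₂ (⊨-∧ φᵢ φ' (proj₂ (⊨-∧ ψ' (φᵢ ∧ᶠ φ') hψ'φᵢφ')))

  opt-step-a : ∀ {s ψ s'} → OptStep s a ψ s' → Step s a ψ s'
  opt-step-a (inj₁ st)      = st
  opt-step-a (inj₂ (() , _))

  single : ∀ {R s φ t α ψ t' φ' s'} →
    Step t α ψ t' → R s φ t → R s' φ' t' → Answer R s t α s'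
  single st r r' = record
    { path = done ; move = inj₁ st ; rel₁ = r ; rel₂ = r' }

  single-ok : ∀ {R : Rel} {s φ t α ψ t' φ' s' w}
    (st : Step t α ψ t') (r : R s φ t) (r' : R s' φ' t') →
    w ⊨ ψ → w ⊨ φ → w ⊨ φ' → w ⊨ Answer.cond (single {R = R} st r r')
  single-ok {φ = φ} {ψ = ψ} {φ' = φ'} _ _ _ hψ hφ hφ' =
    ∧ᶠ-intro tt (ψ ∧ᶠ (φ ∧ᶠ φ')) refl (∧ᶠ-intro ψ (φ ∧ᶠ φ') hψ (∧ᶠ-intro φ φ' hφ hφ'))

  Answered : Rel → St → FExpr n → St → Act → FExpr n → St → Set
  Answered R s φ t α ψ s' = Σ ℕ λ k → Σ (Fin k → Answer R s t α s') λ ans →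
    ∀ w → w ⊨ (φ ∧ᶠ ψ) → ∃ λ i → w ⊨ Answer.cond (ans i)

  by-step : ∀ {R s φ t α ψ t' ψ' s' φ'} → Step t α ψ' t' → R s φ t → R s' φ' t' →
    (∀ w → w ⊨ (φ ∧ᶠ ψ) → w ⊨ ψ' × w ⊨ φ') → Answered R s φ t α ψ s'
  by-step {R} {φ = φ} {ψ = ψ} st r r' ok = 1 , (λ _ → single st r r') , λ w h →
    zero , single-ok {R = R} st r r' (proj₁ (ok w h)) (proj₁ (⊨-∧ φ ψ h)) (proj₂ (ok w h))

module Union (S S' : FTS n) where
  open Bisim (θ⊎ S S') public
  open Replies (θ⊎ S S') public

  left-step : ∀ {s α ψ x} → Step (inj₁ s) α ψ x →
    ∃ λ s' → x ≡ inj₁ s' × Bisim.Step (θ S) s α ψ s'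
  left-step {x = inj₁ s'} st = s' , refl , st
  left-step {x = inj₂ _}  (refl , _ , ())

  right-step : ∀ {s α ψ x} → Step (inj₂ s) α ψ x →
    ∃ λ s' → x ≡ inj₂ s' × Bisim.Step (θ S') s α ψ s'
  right-step {x = inj₂ s'} st = s' , refl , st
  right-step {x = inj₁ _}  (refl , _ , ())

  Right : UState S S' → Set
  Right x = ∃ λ z → x ≡ inj₂ z

  path-right : ∀ {x η y} → TauPath x η y → Right x → Right y
  path-right done          rx       = rx
  path-right (more {s'' = x'} st p) (_ , refl) with right-step {x = x'} st
  ... | z , refl , _ = path-right p (z , refl)

  opt-right : ∀ {x α ψ y} → OptStep x α ψ y → Right x → Right y
  opt-right {y = y} (inj₁ st) (_ , refl) with right-step {x = y} st
  ... | z , refl , _ = z , refl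
  opt-right (inj₂ (_ , refl , _)) rx = rx

  reply-right : ∀ {R t α w y} → Right t → (r : Reply R t α w y) → Right (Reply.t' r)
  reply-right rt r = opt-right (Reply.move r) (path-right (Reply.path r) rt)

  module TauFree (τ-free : ∀ s s' → ¬ Satisfiable (θ S s τ s')) where

    no-τ : ∀ {s ψ x} → Step (inj₁ s) τ ψ x → ⊥
    no-τ {s} {x = x} st with left-step {x = x} st
    ... | s' , refl , (refl , sat) = τ-free s s' sat

    single-step : ∀ {s η t̂ ψ t'} →
      TauPath (inj₁ s) η t̂ → OptStep t̂ a ψ t' → Step (inj₁ s) a ψ t'
    single-step done        m = opt-step-a m
    single-step (more {s'' = x} st _) _ = ⊥-elim (no-τ {x = x} st)

    stutter : ∀ {s η t̂ ψ t'} → TauPath (inj₁ s) η t̂ → OptStep t̂ τ ψ t' → t' ≡ inj₁ s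
    stutter {t' = t'} done (inj₁ st)             = ⊥-elim (no-τ {x = t'} st)
    stutter done           (inj₂ (_ , refl , _)) = refl
    stutter (more {s'' = x} st _) _              = ⊥-elim (no-τ {x = x} st)

    reply-step : ∀ {R s w y} (r : Reply R (inj₁ s) a w y) →
      Step (inj₁ s) a (Reply.ψ r) (Reply.t' r)
    reply-step r = single-step (Reply.path r) (Reply.move r)

    module _ {R : Rel} (isB : IsBranchingFeatureBisim R) where

      follow-τ : ∀ {x φ s η x̂ w} → R x φ (inj₁ s) → w ⊨ φ → TauPath x η x̂ → w ⊨ η →
        ∃ λ φ₁ → R x̂ φ₁ (inj₁ s) × w ⊨ φ₁
      follow-τ r h done _ = _ , r , h
      follow-τ r h (more {ψ = ψ} {η = η} st p) hψη =
        follow-τ (subst (R _ (Reply.φ' m)) (stutter (Reply.path m) (Reply.move m))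
                   (Reply.related m))
                 (Reply.related-ok m) p (proj₂ (⊨-∧ ψ η hψη))
        where
        m = reply isB r st h (proj₁ (⊨-∧ ψ η hψη))

      answer-weak : ∀ {x φ s w y} → R x φ (inj₁ s) → w ⊨ φ →
        (m : Reply R x a w y) → Reply R (inj₁ s) a w (Reply.t' m)
      answer-weak r h m with follow-τ r h (Reply.path m) (Reply.path-ok m)
      ... | _ , r₁ , h₁ = reply isB r₁ (opt-step-a (Reply.move m)) h₁ (Reply.move-ok m)

module SGUnion (G : Graph n) (S' : FTS n) where
  open Union (SG G) S' public

  sg-step : ∀ {s α ψ x} → Step (inj₁ s) α ψ x →
    ∃ λ s' → x ≡ inj₁ s' × Move (nbhd G) var s α ψ s'
  sg-step {s} {α} {x = x} st with left-step {x = x} st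
  ... | s' , refl , (eq , sat) = s' , refl , sg-move G s α s' eq sat

  sg-enter : ∀ v → Step (inj₁ root) a (nbhd G v) (inj₁ (mid v))
  sg-enter v = refl , v , nbhd-self G v

  sg-exit : ∀ v → Step (inj₁ (mid v)) a (var v) (inj₁ sink)
  sg-exit v = refl , v , var-self v

Proper : ∀ {k} → Graph n → (Fin n → Fin k) → Set
Proper G c = ∀ u v → adj G u v ≡ true → c u ≡ c v → ⊥

loopless : ∀ (G : Graph n) {u v} → adj G u v ≡ true → u ≢ v
loopless G {u} e refl with trans (sym (Graph.irrefl G u)) e
... | ()

-- If c never uses colour i, punching i out of the palette gives a colouring with
-- one colour fewer that separates the same vertices, so properness is kept.
omit : ∀ {k} (i : Fin (suc k)) (c : Fin n → Fin (suc k)) → (∀ v → c v ≢ i) → Fin n → Fin k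
omit i c unused v = punchOut (λ i≡cv → unused v (sym i≡cv))

omit-injective : ∀ {k} (i : Fin (suc k)) c unused (u v : Fin n) →
  omit i c unused u ≡ omit i c unused v → c u ≡ c v
omit-injective i c unused u v =
  punchOut-injective (λ i≡cu → unused u (sym i≡cu)) (λ i≡cv → unused v (sym i≡cv))

omit-proper : ∀ {k} (G : Graph n) (i : Fin (suc k)) c unused →
  Proper G c → Proper G (omit i c unused)
omit-proper G i c unused proper u v e eq = proper u v e (omit-injective i c unused u v eq)

two-unused : ∀ {m} (G : Graph n) (c : Fin n → Fin m) → Proper G c →
  (i j : Fin m) → i ≢ j → (∀ v → c v ≢ i) → (∀ v → c v ≢ j) →
  ∃ λ k → m ≡ 2 + k × Colorable G k
two-unused {m = suc zero}  _ _ _ zero zero i≢j _ _ = ⊥-elim (i≢j refl)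
two-unused {n} {suc (suc k)} G c proper i j i≢j unusedᵢ unusedⱼ =
  k , refl , omit j′ c′ unusedⱼ′ , omit-proper G j′ c′ unusedⱼ′ (omit-proper G i c unusedᵢ proper)
  where
  c′ : Fin n → Fin (suc k)
  c′ = omit i c unusedᵢ
  j′ : Fin (suc k)
  j′ = punchOut i≢j
  unusedⱼ′ : ∀ v → c′ v ≢ j′
  unusedⱼ′ v eq = unusedⱼ v (punchOut-injective (λ i≡cv → unusedᵢ v (sym i≡cv)) i≢j eq)

module UpperBound (G : Graph n) {χ : ℕ} (c : Fin n → Fin χ) (proper : Proper G c) where

  inClass : Fin χ → Fin n → Bool
  inClass k u = does (c u ≟ k)

  enterClass leaveClass : Fin χ → FExpr n
  enterClass k = ⋁ (inClass k) (nbhd G) (allFin n)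
  leaveClass k = ⋁ (inClass k) var (allFin n)

  merged : FTS n
  merged = record { states = 2 + χ ; θ = layered enterClass leaveClass ; init = root }

  open SGUnion G merged

  in-own-class : ∀ v → inClass (c v) v ≡ true
  in-own-class v = dec-true (c v ≟ c v) refl

  enterClass-intro : ∀ {w} v → w ⊨ nbhd G v → w ⊨ enterClass (c v)
  enterClass-intro v = ⋁-intro (inClass (c v)) (nbhd G) (∈-allFin v) (in-own-class v)

  leaveClass-self : ∀ v → v ⊨ leaveClass (c v)
  leaveClass-self v = ⋁-intro (inClass (c v)) var (∈-allFin v) (in-own-class v) (var-self v)

  -- A colour class meets the closed neighbourhood of v only in v, as it is an
  -- independent set: this is where properness of c is used.
  leaveClass-unique : ∀ {w v} → w ⊨ nbhd G v → w ⊨ leaveClass (c v) → w ≡ v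
  leaveClass-unique {w} {v} hN hL with nbhd-elim G hN
  ... | inj₂ w≡v = w≡v
  ... | inj₁ e with ⋁-elim (inClass (c v)) var (allFin n) hL
  ...   | u , same-class , hu with ⊨-var {w = w} {u = u} hu
  ...     | refl = ⊥-elim (proper u v e (does-true (c u ≟ c v) same-class))

  data Matched : UState (SG G) merged → FExpr n → UState (SG G) merged → Set where
    roots : Matched (inj₁ root) tt (inj₂ root)
    mids  : ∀ v → Matched (inj₁ (mid v)) (nbhd G v) (inj₂ (mid (c v)))
    sinks : Matched (inj₁ sink) tt (inj₂ sink)

  R : Rel
  R x φ y = Matched x φ y ⊎ Matched y φ x

  merged-enter : ∀ v → Step (inj₂ root) a (enterClass (c v)) (inj₂ (mid (c v)))
  merged-enter v = refl , v , enterClass-intro v (nbhd-self G v)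

  merged-exit : ∀ v → Step (inj₂ (mid (c v))) a (leaveClass (c v)) (inj₂ sink)
  merged-exit v = refl , v , leaveClass-self v

  -- The merged entry into class k is answered, product by product, by entering
  -- s_u for a vertex u of colour k (u₀ stands in for vertices of other colours).
  enter-answer : ∀ {k u} → c u ≡ k → Answer R (inj₂ root) (inj₁ root) a (inj₂ (mid k))
  enter-answer {u = u} refl = single (sg-enter u) (inj₂ roots) (inj₂ (mids u))

  enter-answer-ok : ∀ {k u w} (p : c u ≡ k) → w ⊨ nbhd G u → w ⊨ Answer.cond (enter-answer p)
  enter-answer-ok {u = u} refl h =
    single-ok {R = R} (sg-enter u) (inj₂ roots) (inj₂ (mids u)) h refl h

  class-answers : ∀ {k u₀} → c u₀ ≡ k → Fin n → Answer R (inj₂ root) (inj₁ root) a (inj₂ (mid k))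
  class-answers {k} p₀ u with c u ≟ k
  ... | yes p = enter-answer p
  ... | no _  = enter-answer p₀

  class-answers-ok : ∀ {k u₀ u w} (p₀ : c u₀ ≡ k) → c u ≡ k → w ⊨ nbhd G u →
    w ⊨ Answer.cond (class-answers p₀ u)
  class-answers-ok {k} {u = u} p₀ p h with c u ≟ k
  ... | yes p′ = enter-answer-ok p′ h
  ... | no ¬p  = ⊥-elim (¬p p)

  forth : ∀ {s φ t α ψ s'} → Matched s φ t → Step s α ψ s' → Answered R s φ t α ψ s'
  forth {s' = x} roots st with sg-step {x = x} st
  ... | _ , refl , enter v =
    by-step {φ = tt} {ψ = nbhd G v} (merged-enter v) (inj₁ roots) (inj₁ (mids v))
      λ w h → let hv = proj₂ (⊨-∧ tt (nbhd G v) h) in enterClass-intro v hv , hv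
  forth {s' = x} (mids v) st with sg-step {x = x} st
  ... | _ , refl , exit .v =
    by-step {φ = nbhd G v} {ψ = var v} (merged-exit v) (inj₁ (mids v)) (inj₁ sinks) ok
    where
    ok : ∀ w → w ⊨ (nbhd G v ∧ᶠ var v) → w ⊨ leaveClass (c v) × w ⊨ tt
    ok w h with ⊨-var {w = w} {u = v} (proj₂ (⊨-∧ (nbhd G v) (var v) h))
    ... | refl = leaveClass-self v , refl
  forth {s' = x} sinks st with sg-step {x = x} st
  ... | _ , refl , ()

  class-answered : ∀ k → Satisfiable (enterClass k) →
    Answered R (inj₂ root) tt (inj₁ root) a (enterClass k) (inj₂ (mid k))
  class-answered k (_ , h₀) with ⋁-elim (inClass k) (nbhd G) (allFin n) h₀
  ... | u₀ , b₀ , _ = n , class-answers p₀ , covered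
    where
    p₀ : c u₀ ≡ k
    p₀ = does-true (c u₀ ≟ k) b₀
    covered : ∀ w → w ⊨ (tt ∧ᶠ enterClass k) → ∃ λ i → w ⊨ Answer.cond (class-answers p₀ i)
    covered w h with ⋁-elim (inClass k) (nbhd G) (allFin n) (proj₂ (⊨-∧ tt (enterClass k) h))
    ... | u , b , hu = u , class-answers-ok p₀ (does-true (c u ≟ k) b) hu

  back : ∀ {s φ t α ψ s'} → Matched t φ s → Step s α ψ s' → Answered R s φ t α ψ s'
  back {α = α} {s' = x} roots st with right-step {x = x} st
  ... | s' , refl , (eq , sat) with layered-move root α s' eq sat
  ... | enter k = class-answered k sat
  back {α = α} {s' = x} (mids v) st with right-step {x = x} st
  ... | s' , refl , (eq , sat) with layered-move (mid (c v)) α s' eq sat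
  ... | exit .(c v) =
    by-step {φ = nbhd G v} {ψ = leaveClass (c v)} (sg-exit v) (inj₂ (mids v)) (inj₂ sinks) ok
    where
    ok : ∀ w → w ⊨ (nbhd G v ∧ᶠ leaveClass (c v)) → w ⊨ var v × w ⊨ tt
    ok w h with ⊨-∧ (nbhd G v) (leaveClass (c v)) h
    ... | hN , hL with leaveClass-unique hN hL
    ... | refl = var-self v , refl
  back {α = α} {s' = x} sinks st with right-step {x = x} st
  ... | s' , refl , (eq , sat)
      with layered-move {L = enterClass} {M = leaveClass} sink α s' eq sat
  ... | ()

  -- Coherence: the products reaching s_v are those satisfying nbhd G v.
  coherent : Coherent (SG G) merged R
  coherent _ _ _ (inj₁ roots)    _ _       = refl
  coherent _ _ _ (inj₁ (mids v)) _ reaches = reach-mid G reaches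
  coherent _ _ _ (inj₁ sinks)    _ _       = refl
  coherent _ _ _ (inj₂ ()) _ _

  bisimilar : CBFBisimilar (SG G) merged
  bisimilar = R , (swap , answers) , coherent , inj₁ roots
    where
    answers : ∀ {s φ t α ψ s'} → R s φ t → Step s α ψ s' → Answered R s φ t α ψ s'
    answers (inj₁ m) = forth m
    answers (inj₂ m) = back m

module LowerBound (G : Graph n) (S' : FTS n) where
  open SGUnion G S'
  open TauFree (sg-τ-free G)

  sink-stuck : ∀ {α ψ x} → Step (inj₁ sink) α ψ x → ⊥
  sink-stuck {x = x} st with sg-step {x = x} st
  ... | _ , refl , ()

  mid-exit : ∀ {v α ψ x} → Step (inj₁ (mid v)) α ψ x → ψ ≡ var v × x ≡ inj₁ sink
  mid-exit {x = x} st with sg-step {x = x} st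
  ... | _ , refl , exit _ = refl , refl

  module _ {R : Rel} (isB : IsBranchingFeatureBisim R) (coherent : Coherent (SG G) S' R)
           (start : R (inj₁ root) tt (inj₂ (init S'))) where

    symmetric : ∀ {x φ y} → R x φ y → R y φ x
    symmetric = proj₁ isB

    enter-reply : ∀ v → Reply R (inj₂ (init S')) a v (inj₁ (mid v))
    enter-reply v = reply isB start (sg-enter v) refl (nbhd-self G v)

    cU : Fin n → UState (SG G) S'
    cU v = Reply.t' (enter-reply v)

    exit-reply : ∀ v → Reply R (cU v) a v (inj₁ sink)
    exit-reply v = reply isB (Reply.related (enter-reply v)) (sg-exit v)
                     (Reply.related-ok (enter-reply v)) (var-self v)

    sink-partner : ∀ {x φ w y} → R x φ (inj₁ sink) → w ⊨ φ → Reply R x a w y → ⊥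
    sink-partner r h m = sink-stuck {x = Reply.t' answer} (reply-step answer)
      where answer = answer-weak isB r h m

    -- Adjacent vertices get different states: by coherence cU v would be a partner
    -- of s_u for P_v, but s_u only moves under f_u.
    adjacent-apart : ∀ {u v} → adj G u v ≡ true → cU u ≢ cU v
    adjacent-apart {u} {v} e cu≡cv = loopless G e u≡v
      where
      open Reply (enter-reply u) using (related) renaming (φ' to φᵤ)
      v-ok : v ⊨ φᵤ
      v-ok = coherent (mid u) φᵤ (cU u) related v
               (reach-mid-intro G (nbhd-adj G (trans (Graph.sym G v u) e)))
      answer : Reply R (inj₁ (mid u)) a v (Reply.t' (exit-reply v))
      answer = answer-weak isB (subst (λ x → R x φᵤ (inj₁ (mid u))) cu≡cv (symmetric related))
                 v-ok (exit-reply v)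
      u≡v : u ≡ v
      u≡v = ⊨-var {w = v} {u = u} (subst (v ⊨_) guard≡f_u (Reply.move-ok answer))
        where guard≡f_u = proj₁ (mid-exit {x = Reply.t' answer} (reply-step answer))

    -- cU v is not the initial state: matched with s_v it would have to answer
    -- the move into cU v by s_v → s₂, while cU v still moves.
    not-initial : ∀ v → cU v ≢ inj₂ (init S')
    not-initial v cv≡init =
      sink-partner (subst (R (cU v) (Reply.φ' answer)) reaches-sink (Reply.related answer))
                   (Reply.related-ok answer) (exit-reply v)
      where
      open Reply (enter-reply v) using (related; related-ok) renaming (φ' to φᵥ)
      answer : Reply R (inj₁ (mid v)) a v (cU v)
      answer = answer-weak isB
                 (subst (λ x → R x φᵥ (inj₁ (mid v))) cv≡init (symmetric related))
                 related-ok (enter-reply v)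
      reaches-sink : Reply.t' answer ≡ inj₁ sink
      reaches-sink = proj₂ (mid-exit {x = Reply.t' answer} (reply-step answer))

    -- All products reach s₂, so by coherence
    -- d is a partner of s₂ for every product, hence different from the initial
    -- state and from every cU u, which all have weak a-moves.
    module _ (v₀ : Fin n) where
      open Reply (exit-reply v₀) using () renaming (t' to d; φ' to φd; related to d-related)

      φd-valid : ∀ w → w ⊨ φd
      φd-valid w = coherent sink φd d d-related w (reach-sink G w)

      d-stuck : ∀ {x w y} → d ≡ x → Reply R x a w y → ⊥
      d-stuck refl m = sink-partner (symmetric d-related) (φd-valid _) m

      colourOf : ∀ v → Right (cU v)
      colourOf v = reply-right (init S' , refl) (enter-reply v)

      colour : Fin n → Fin (states S')
      colour v = proj₁ (colourOf v)

      dS : Fin (states S')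
      dS = proj₁ (reply-right (colourOf v₀) (exit-reply v₀))

      colouring : ∃ λ k → states S' ≡ 2 + k × Colorable G k
      colouring = two-unused G colour proper (init S') dS init≢dS avoids-init avoids-dS
        where
        cU≡colour : ∀ v → cU v ≡ inj₂ (colour v)
        cU≡colour v = proj₂ (colourOf v)
        d≡dS : d ≡ inj₂ dS
        d≡dS = proj₂ (reply-right (colourOf v₀) (exit-reply v₀))
        proper : Proper G colour
        proper u v e eq =
          adjacent-apart e (trans (cU≡colour u) (trans (cong inj₂ eq) (sym (cU≡colour v))))
        init≢dS : init S' ≢ dS
        init≢dS eq = d-stuck (trans d≡dS (cong inj₂ (sym eq))) (enter-reply v₀)
        avoids-init : ∀ v → colour v ≢ init S'
        avoids-init v eq = not-initial v (trans (cU≡colour v) (cong inj₂ eq))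
        avoids-dS : ∀ v → colour v ≢ dS
        avoids-dS v eq =
          d-stuck (trans d≡dS (trans (cong inj₂ (sym eq)) (sym (cU≡colour v)))) (exit-reply v)

theorem8 : ∀ {n} → 1 ≤ n → (G : Graph n) (S' : FTS n) →
    CBFBisimilar (SG G) S' →
    (∀ (S'' : FTS n) → CBFBisimilar (SG G) S'' → states S' ≤ states S'') →
    ∀ χ → IsChromaticNumber G χ → states S' ≡ χ + 2
theorem8 1≤n G S' (R , isB , coherent , start) minimal χ ((c , proper) , least) =
  ≤-antisym upper lower
  where
  upper : states S' ≤ χ + 2
  upper = ≤-trans (minimal _ (UpperBound.bisimilar G c proper)) (≤-reflexive (+-comm 2 χ))

  lower : χ + 2 ≤ states S'
  lower = fewer-colours (LowerBound.colouring G S' isB coherent start (fromℕ< 1≤n))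
    where
    fewer-colours : (∃ λ k → states S' ≡ 2 + k × Colorable G k) → χ + 2 ≤ states S'
    fewer-colours (k , states≡2+k , colourable) = begin
      χ + 2      ≤⟨ +-monoˡ-≤ 2 (least k colourable) ⟩
      k + 2      ≡⟨ +-comm k 2 ⟩
      2 + k      ≡⟨ sym states≡2+k ⟩
      states S'  ∎
      where open ≤-Reasoning
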